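{- Let $r$ be a positive integer. For every $n \ge 1$, $k \in \{0, 1,\dots,n\}$ and $j \in \{0, 1,\dots,r-1\}$, \[ p^{\langle r,j \rangle}_{n,k}(x) = x \sum_{\ell=j+1}^{r-1} \sum_{i=0}^{n-1} p^{\langle r, \ell \rangle}_{n-1,i}(x) + x \sum_{i=0}^{k-1} p^{\langle r,j \rangle}_{n-1,i}(x) + \sum_{i=k}^{n-1} p^{\langle r,j \rangle}_{n-1,i}(x) + \sum_{\ell=0}^{j-1} \sum_{i=0}^{n-1} p^{\langle r, \ell \rangle}_{n-1,i}(x). \]
   Context: For $h(x)=\sum_{i=0}^n c_ix^i\in\mathbb{R}_n[x]$ (real polynomials of degree at most $n$), $\mathcal{D}_n(h(x))\in\mathbb{R}_n[x]$ is defined by $\sum_{m\ge0}f(m)x^m=\mathcal{D}_n(h(x))/(1-x)^{n+1}$ where $f(x)=\sum_{i=0}^n c_ix^i(1+x)^{n-i}$; set $p_{n,k}(x)=\mathcal{D}_n(x^k)$ for $0\le k\le n$. The $j$th Veronese $r$-section operator is $\mathcal{S}^r_j(\sum_{m\ge0}a_mx^m)=\sum_{m\ge0}a_{rm+j}x^m$. Define $p^{\langle r,j\rangle}_{n,k}(x)=\mathcal{S}^r_j\big((1+x+x^2+\cdots+x^{r-1})^n p_{n,k}(x)\big)$ for $n\in\mathbb{N}$, $0\le k\le n$, $0\le j\le r-1$. -}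

module Defs where

open import Data.Nat using (ℕ; zero; suc; _∸_; _<ᵇ_)
  renaming (_+_ to _+ℕ_; _*_ to _*ℕ_; _^_ to _^ℕ_)
open import Data.Bool using (if_then_else_)
open import Data.Integer using (ℤ; +_; -_; _+_; _*_)

-- Formal power series with integer coefficients: coefficient functions.
-- (All polynomials in this statement have integer coefficients.)
Series : Set
Series = ℕ → ℤ

zeroS : Series
zeroS _ = + 0

infixl 6 _⊕_
_⊕_ : Series → Series → Series
(a ⊕ b) t = a t + b t

-- Cauchy product: (a ⊛ b)_t = Σ_{i=0}^{t} a_i b_{t-i}
convAux : Series → Series → ℕ → ℕ → ℤ
convAux a b t zero    = + 0
convAux a b t (suc i) = a i * b (t ∸ i) + convAux a b t i

infixl 7 _⊛_
_⊛_ : Series → Series → Series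
(a ⊛ b) t = convAux a b t (suc t)

oneS : Series
oneS zero    = + 1
oneS (suc _) = + 0

powS : Series → ℕ → Series
powS a zero    = oneS
powS a (suc n) = a ⊛ powS a n

xS : Series → Series
xS a zero    = + 0
xS a (suc t) = a t

oneMinusX : Series
oneMinusX zero          = + 1
oneMinusX (suc zero)    = - (+ 1)
oneMinusX (suc (suc _)) = + 0

geomS : ℕ → Series
geomS r t = if t <ᵇ r then + 1 else + 0

sumTo : ℕ → (ℕ → Series) → Series
sumTo zero    g = zeroS
sumTo (suc n) g = sumTo n g ⊕ g n

-- sum_{i=lo}^{hi-1} g i  (empty if hi ≤ lo)
sumRange : ℕ → ℕ → (ℕ → Series) → Series
sumRange lo hi g = sumTo (hi ∸ lo) (λ i → g (lo +ℕ i))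

-- f(m) for h(x) = x^k : f(x) = x^k (1+x)^{n-k}
fVal : ℕ → ℕ → ℕ → ℕ
fVal n k m = (m ^ℕ k) *ℕ ((suc m) ^ℕ (n ∸ k))

fSeries : ℕ → ℕ → Series
fSeries n k m = + fVal n k m

-- p_{n,k}(x) = D_n(x^k) = (1-x)^{n+1} Σ_{m≥0} f(m) x^m
p : ℕ → ℕ → Series
p n k = powS oneMinusX (suc n) ⊛ fSeries n k

section : ℕ → ℕ → Series → Series
section r j a m = a (r *ℕ m +ℕ j)

pr : ℕ → ℕ → ℕ → ℕ → Series
pr r j n k = section r j (powS (geomS r) n ⊛ p n k)

-- Write p n k = (1-x)^(n+1) F n k with F n k = Σ_m m^k (m+1)^(n-k) x^m. Since (m+1) - m = 1,
-- the products m^k (m+1)^(n-k) telescope, and this gives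
--   (1-x) F (n+1) k = x Σ_{i<k} F n i + Σ_{k≤i≤n} F n i,
-- hence the same recurrence for p (n+1) k and, after multiplying by G^n where
-- G = 1 + x + ⋯ + x^(r-1), for G^n p (n+1) k. It remains to take the j-th r-section of G (x U + V):
-- the coefficient of x^(rm+j) in G A is the sum of the r consecutive coefficients of A ending at
-- rm + j, i.e. those of S^r_l A at m for l ≤ j and at m - 1 for l > j; the factor x in front of U
-- moves that window by one place, which is why U and V end up weighted differently at l = j.
module Submission where

open import Defs
open import Data.Nat as ℕ using (ℕ; zero; suc; _∸_; _≤_; _<_; s≤s; s≤s⁻¹; _^_)
import Data.Nat.Properties as ℕₚ
import Data.Nat.Tactic.RingSolver as ℕ-Solver
open import Data.Integer using (ℤ; +_; -_; _+_; _*_)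
import Data.Integer.Properties as ℤₚ
import Data.Integer.Tactic.RingSolver as ℤ-Solver
open import Relation.Binary.PropositionalEquality

tailS : Series → Series
tailS a t = a (suc t)

scaleS : ℤ → Series → Series
scaleS c a t = c * a t

⊛-at-0 : ∀ a b → (a ⊛ b) 0 ≡ a 0 * b 0
⊛-at-0 a b = ℤₚ.+-identityʳ (a 0 * b 0)

⊛-at-suc : ∀ a b t → (a ⊛ b) (suc t) ≡ (tailS a ⊛ b) t + a 0 * b (suc t)
⊛-at-suc a b t = peel (suc t)
  where
  peel : ∀ i → convAux a b (suc t) (suc i) ≡ convAux (tailS a) b t i + a 0 * b (suc t)
  peel zero    = ℤₚ.+-comm (a 0 * b (suc t)) (+ 0)
  peel (suc i) = trans (cong (_+_ (a (suc i) * b (t ∸ i))) (peel i))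
                       (sym (ℤₚ.+-assoc (a (suc i) * b (t ∸ i)) _ _))

⊛-cong : ∀ {a a′ b b′} → a ≗ a′ → b ≗ b′ → a ⊛ b ≗ a′ ⊛ b′
⊛-cong {a} {a′} {b} {b′} a≗a′ b≗b′ t = go (suc t)
  where
  go : ∀ i → convAux a b t i ≡ convAux a′ b′ t i
  go zero    = refl
  go (suc i) = cong₂ _+_ (cong₂ _*_ (a≗a′ i) (b≗b′ (t ∸ i))) (go i)

⊛-congˡ : ∀ {a a′} b → a ≗ a′ → a ⊛ b ≗ a′ ⊛ b
⊛-congˡ b a≗a′ = ⊛-cong a≗a′ (λ _ → refl)

⊛-congʳ : ∀ a {b b′} → b ≗ b′ → a ⊛ b ≗ a ⊛ b′
⊛-congʳ a = ⊛-cong {a} (λ _ → refl)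

⊛-comm : ∀ a b → a ⊛ b ≗ b ⊛ a
⊛-comm a b zero = begin
  (a ⊛ b) 0  ≡⟨ ⊛-at-0 a b ⟩
  a 0 * b 0  ≡⟨ ℤₚ.*-comm (a 0) (b 0) ⟩
  b 0 * a 0  ≡⟨ ⊛-at-0 b a ⟨
  (b ⊛ a) 0  ∎
  where open ≡-Reasoning
⊛-comm a b (suc zero) = begin
  (a ⊛ b) 1                 ≡⟨ ⊛-at-suc a b 0 ⟩
  (tailS a ⊛ b) 0 + a 0 * b 1 ≡⟨ cong (_+ a 0 * b 1) (⊛-at-0 (tailS a) b) ⟩
  a 1 * b 0 + a 0 * b 1     ≡⟨ swap (a 1) (b 0) (a 0) (b 1) ⟩
  b 1 * a 0 + b 0 * a 1     ≡⟨ cong (_+ b 0 * a 1) (⊛-at-0 (tailS b) a) ⟨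
  (tailS b ⊛ a) 0 + b 0 * a 1 ≡⟨ ⊛-at-suc b a 0 ⟨
  (b ⊛ a) 1                 ∎
  where
  open ≡-Reasoning
  swap : ∀ x y z w → x * y + z * w ≡ w * z + y * x
  swap = ℤ-Solver.solve-∀
⊛-comm a b (suc (suc t)) = begin
  (a ⊛ b) (2 ℕ.+ t)                                  ≡⟨ ⊛-at-suc a b (suc t) ⟩
  (tailS a ⊛ b) (suc t) + a 0 * b (2 ℕ.+ t)          ≡⟨ cong (_+ a 0 * b (2 ℕ.+ t)) (⊛-comm (tailS a) b (suc t)) ⟩
  (b ⊛ tailS a) (suc t) + a 0 * b (2 ℕ.+ t)          ≡⟨ cong (_+ a 0 * b (2 ℕ.+ t)) (⊛-at-suc b (tailS a) t) ⟩
  ((tailS b ⊛ tailS a) t + b 0 * a (2 ℕ.+ t)) + a 0 * b (2 ℕ.+ t)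
    ≡⟨ cong (λ z → (z + b 0 * a (2 ℕ.+ t)) + a 0 * b (2 ℕ.+ t)) (⊛-comm (tailS b) (tailS a) t) ⟩
  ((tailS a ⊛ tailS b) t + b 0 * a (2 ℕ.+ t)) + a 0 * b (2 ℕ.+ t)
    ≡⟨ swap ((tailS a ⊛ tailS b) t) (b 0 * a (2 ℕ.+ t)) (a 0 * b (2 ℕ.+ t)) ⟩
  ((tailS a ⊛ tailS b) t + a 0 * b (2 ℕ.+ t)) + b 0 * a (2 ℕ.+ t)
    ≡⟨ cong (_+ b 0 * a (2 ℕ.+ t)) (⊛-at-suc a (tailS b) t) ⟨
  (a ⊛ tailS b) (suc t) + b 0 * a (2 ℕ.+ t)          ≡⟨ cong (_+ b 0 * a (2 ℕ.+ t)) (⊛-comm a (tailS b) (suc t)) ⟩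
  (tailS b ⊛ a) (suc t) + b 0 * a (2 ℕ.+ t)          ≡⟨ ⊛-at-suc b a (suc t) ⟨
  (b ⊛ a) (2 ℕ.+ t)                                  ∎
  where
  open ≡-Reasoning
  swap : ∀ x y z → (x + y) + z ≡ (x + z) + y
  swap = ℤ-Solver.solve-∀

⊛-distribʳ-⊕ : ∀ a b c → (a ⊕ b) ⊛ c ≗ (a ⊛ c) ⊕ (b ⊛ c)
⊛-distribʳ-⊕ a b c t = go (suc t)
  where
  go : ∀ i → convAux (a ⊕ b) c t i ≡ convAux a c t i + convAux b c t i
  go zero    = refl
  go (suc i) = trans (cong (_+_ ((a i + b i) * c (t ∸ i))) (go i))
                     (regroup (a i) (b i) (c (t ∸ i)) (convAux a c t i) (convAux b c t i))
    where
    regroup : ∀ x y w u v → (x + y) * w + (u + v) ≡ (x * w + u) + (y * w + v)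
    regroup = ℤ-Solver.solve-∀

⊛-distribˡ-⊕ : ∀ a b c → a ⊛ (b ⊕ c) ≗ (a ⊛ b) ⊕ (a ⊛ c)
⊛-distribˡ-⊕ a b c t = begin
  (a ⊛ (b ⊕ c)) t          ≡⟨ ⊛-comm a (b ⊕ c) t ⟩
  ((b ⊕ c) ⊛ a) t          ≡⟨ ⊛-distribʳ-⊕ b c a t ⟩
  (b ⊛ a) t + (c ⊛ a) t    ≡⟨ cong₂ _+_ (⊛-comm b a t) (⊛-comm c a t) ⟩
  (a ⊛ b) t + (a ⊛ c) t    ∎
  where open ≡-Reasoning

scaleS-⊛ : ∀ c a b → scaleS c a ⊛ b ≗ scaleS c (a ⊛ b)
scaleS-⊛ c a b t = go (suc t)
  where
  go : ∀ i → convAux (scaleS c a) b t i ≡ c * convAux a b t i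
  go zero    = sym (ℤₚ.*-zeroʳ c)
  go (suc i) = trans (cong (_+_ (c * a i * b (t ∸ i))) (go i))
                     (factor c (a i) (b (t ∸ i)) (convAux a b t i))
    where
    factor : ∀ k x y u → k * x * y + k * u ≡ k * (x * y + u)
    factor = ℤ-Solver.solve-∀

⊛-zeroˡ : ∀ a → zeroS ⊛ a ≗ zeroS
⊛-zeroˡ a t = go (suc t)
  where
  go : ∀ i → convAux zeroS a t i ≡ + 0
  go zero    = refl
  go (suc i) = cong₂ _+_ (ℤₚ.*-zeroˡ (a (t ∸ i))) (go i)

⊛-assoc : ∀ a b c → (a ⊛ b) ⊛ c ≗ a ⊛ (b ⊛ c)
⊛-assoc a b c zero = begin
  ((a ⊛ b) ⊛ c) 0      ≡⟨ ⊛-at-0 (a ⊛ b) c ⟩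
  (a ⊛ b) 0 * c 0      ≡⟨ cong (_* c 0) (⊛-at-0 a b) ⟩
  a 0 * b 0 * c 0      ≡⟨ ℤₚ.*-assoc (a 0) (b 0) (c 0) ⟩
  a 0 * (b 0 * c 0)    ≡⟨ cong (a 0 *_) (⊛-at-0 b c) ⟨
  a 0 * (b ⊛ c) 0      ≡⟨ ⊛-at-0 a (b ⊛ c) ⟨
  (a ⊛ (b ⊛ c)) 0      ∎
  where open ≡-Reasoning
⊛-assoc a b c (suc t) = begin
  ((a ⊛ b) ⊛ c) (suc t)
    ≡⟨ ⊛-at-suc (a ⊛ b) c t ⟩
  (tailS (a ⊛ b) ⊛ c) t + (a ⊛ b) 0 * c (suc t)
    ≡⟨ cong₂ _+_ tail-step (cong (_* c (suc t)) (⊛-at-0 a b)) ⟩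
  ((tailS a ⊛ (b ⊛ c)) t + a 0 * (tailS b ⊛ c) t) + a 0 * b 0 * c (suc t)
    ≡⟨ regroup ((tailS a ⊛ (b ⊛ c)) t) ((tailS b ⊛ c) t) (a 0) (b 0) (c (suc t)) ⟩
  (tailS a ⊛ (b ⊛ c)) t + a 0 * ((tailS b ⊛ c) t + b 0 * c (suc t))
    ≡⟨ cong (λ z → (tailS a ⊛ (b ⊛ c)) t + a 0 * z) (⊛-at-suc b c t) ⟨
  (tailS a ⊛ (b ⊛ c)) t + a 0 * (b ⊛ c) (suc t)
    ≡⟨ ⊛-at-suc a (b ⊛ c) t ⟨
  (a ⊛ (b ⊛ c)) (suc t) ∎
  where
  open ≡-Reasoning
  regroup : ∀ x y k l z → (x + k * y) + k * l * z ≡ x + k * (y + l * z)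
  regroup = ℤ-Solver.solve-∀
  tail-step : (tailS (a ⊛ b) ⊛ c) t ≡ (tailS a ⊛ (b ⊛ c)) t + a 0 * (tailS b ⊛ c) t
  tail-step = begin
    (tailS (a ⊛ b) ⊛ c) t                                ≡⟨ ⊛-congˡ c (⊛-at-suc a b) t ⟩
    (((tailS a ⊛ b) ⊕ scaleS (a 0) (tailS b)) ⊛ c) t     ≡⟨ ⊛-distribʳ-⊕ (tailS a ⊛ b) _ c t ⟩
    ((tailS a ⊛ b) ⊛ c) t + (scaleS (a 0) (tailS b) ⊛ c) t
      ≡⟨ cong₂ _+_ (⊛-assoc (tailS a) b c t) (scaleS-⊛ (a 0) (tailS b) c t) ⟩
    (tailS a ⊛ (b ⊛ c)) t + a 0 * (tailS b ⊛ c) t        ∎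

xS-cong : ∀ {a b} → a ≗ b → xS a ≗ xS b
xS-cong a≗b zero    = refl
xS-cong a≗b (suc t) = a≗b t

xS-⊕ : ∀ a b → xS (a ⊕ b) ≗ xS a ⊕ xS b
xS-⊕ a b zero    = refl
xS-⊕ a b (suc t) = refl

xS-⊛ : ∀ a b → xS a ⊛ b ≗ xS (a ⊛ b)
xS-⊛ a b zero    = trans (⊛-at-0 (xS a) b) (ℤₚ.*-zeroˡ (b 0))
xS-⊛ a b (suc t) = trans (⊛-at-suc (xS a) b t)
  (trans (cong (_+_ ((a ⊛ b) t)) (ℤₚ.*-zeroˡ (b (suc t)))) (ℤₚ.+-identityʳ _))

⊛-xS : ∀ a b → a ⊛ xS b ≗ xS (a ⊛ b)
⊛-xS a b t = trans (⊛-comm a (xS b) t) (trans (xS-⊛ b a t) (xS-cong (⊛-comm b a) t))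

⊛-identityˡ : ∀ a → oneS ⊛ a ≗ a
⊛-identityˡ a zero    = trans (⊛-at-0 oneS a) (ℤₚ.*-identityˡ (a 0))
⊛-identityˡ a (suc t) = trans (⊛-at-suc oneS a t)
  (trans (cong₂ _+_ (⊛-zeroˡ a t) (ℤₚ.*-identityˡ (a (suc t)))) (ℤₚ.+-identityˡ _))

sumTo-cong : ∀ n {f g t u} → (∀ i → i < n → f i t ≡ g i u) → sumTo n f t ≡ sumTo n g u
sumTo-cong zero    eq = refl
sumTo-cong (suc n) eq = cong₂ _+_ (sumTo-cong n (λ i i<n → eq i (ℕₚ.m≤n⇒m≤1+n i<n))) (eq n ℕₚ.≤-refl)

sumTo-split : ∀ a b g → sumTo (a ℕ.+ b) g ≗ sumTo a g ⊕ sumTo b (λ i → g (a ℕ.+ i))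
sumTo-split a zero    g t = trans (cong (λ n → sumTo n g t) (ℕₚ.+-identityʳ a)) (sym (ℤₚ.+-identityʳ _))
sumTo-split a (suc b) g t = begin
  sumTo (a ℕ.+ suc b) g t                                       ≡⟨ cong (λ n → sumTo n g t) (ℕₚ.+-suc a b) ⟩
  sumTo (a ℕ.+ b) g t + g (a ℕ.+ b) t                           ≡⟨ cong (_+ g (a ℕ.+ b) t) (sumTo-split a b g t) ⟩
  (sumTo a g t + sumTo b (λ i → g (a ℕ.+ i)) t) + g (a ℕ.+ b) t ≡⟨ ℤₚ.+-assoc (sumTo a g t) _ _ ⟩
  sumTo a g t + (sumTo b (λ i → g (a ℕ.+ i)) t + g (a ℕ.+ b) t) ∎
  where open ≡-Reasoning

sumTo≗sumTo⊕sumRange : ∀ {k n} g → k ≤ n → sumTo n g ≗ sumTo k g ⊕ sumRange k n g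
sumTo≗sumTo⊕sumRange {k} {n} g k≤n t =
  trans (cong (λ n → sumTo n g t) (sym (ℕₚ.m+[n∸m]≡n k≤n))) (sumTo-split k (n ∸ k) g t)

sumRange-empty : ∀ n g → sumRange n n g ≗ zeroS
sumRange-empty n g t = cong (λ d → sumTo d (λ i → g (n ℕ.+ i)) t) (ℕₚ.n∸n≡0 n)

sumTo-head : ∀ n f → sumTo (suc n) f ≗ f 0 ⊕ sumTo n (λ i → f (suc i))
sumTo-head n f t = trans (sumTo-split 1 n f t) (cong (_+ sumTo n (λ i → f (suc i)) t) (ℤₚ.+-identityˡ (f 0 t)))

sumRange-head : ∀ {lo hi} g → lo < hi → sumRange lo hi g ≗ g lo ⊕ sumRange (suc lo) hi g
sumRange-head {lo} {suc h} g (s≤s lo≤h) t = begin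
  sumTo (suc h ∸ lo) f t                  ≡⟨ cong (λ n → sumTo n f t) (ℕₚ.+-∸-assoc 1 lo≤h) ⟩
  sumTo (suc (h ∸ lo)) f t                ≡⟨ sumTo-head (h ∸ lo) f t ⟩
  f 0 t + sumTo (h ∸ lo) (λ i → f (suc i)) t
    ≡⟨ cong₂ _+_ (cong (λ l → g l t) (ℕₚ.+-identityʳ lo))
                 (sumTo-cong (h ∸ lo) (λ i _ → cong (λ l → g l t) (ℕₚ.+-suc lo i))) ⟩
  g lo t + sumRange (suc lo) (suc h) g t  ∎
  where
  open ≡-Reasoning
  f : ℕ → Series
  f i = g (lo ℕ.+ i)

sumTo-⊕ : ∀ n f g → sumTo n (λ i → f i ⊕ g i) ≗ sumTo n f ⊕ sumTo n g
sumTo-⊕ zero    f g t = refl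
sumTo-⊕ (suc n) f g t = trans (cong (_+ (f n t + g n t)) (sumTo-⊕ n f g t))
                              (interchange (sumTo n f t) (sumTo n g t) (f n t) (g n t))
  where
  interchange : ∀ a b c d → (a + b) + (c + d) ≡ (a + c) + (b + d)
  interchange = ℤ-Solver.solve-∀

xS-sumTo : ∀ n f → xS (sumTo n f) ≗ sumTo n (λ i → xS (f i))
xS-sumTo zero    f zero    = refl
xS-sumTo zero    f (suc t) = refl
xS-sumTo (suc n) f t       = trans (xS-⊕ (sumTo n f) (f n) t) (cong (_+ xS (f n) t) (xS-sumTo n f t))

sumTo-⊛ : ∀ n g a → sumTo n g ⊛ a ≗ sumTo n (λ i → g i ⊛ a)
sumTo-⊛ zero    g a = ⊛-zeroˡ a
sumTo-⊛ (suc n) g a t = trans (⊛-distribʳ-⊕ (sumTo n g) (g n) a t) (cong (_+ (g n ⊛ a) t) (sumTo-⊛ n g a t))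

⊛-sumTo : ∀ a n g → a ⊛ sumTo n g ≗ sumTo n (λ i → a ⊛ g i)
⊛-sumTo a n g t = trans (⊛-comm a (sumTo n g) t)
  (trans (sumTo-⊛ n g a t) (sumTo-cong n (λ i _ → ⊛-comm (g i) a t)))

section-sumTo : ∀ r l n g → section r l (sumTo n g) ≗ sumTo n (λ i → section r l (g i))
section-sumTo r l zero    g m = refl
section-sumTo r l (suc n) g m = cong (_+ g n (r ℕ.* m ℕ.+ l)) (section-sumTo r l n g m)

splitSum : ℕ → ℕ → (ℕ → Series) → Series
splitSum k n g = xS (sumTo k g) ⊕ sumRange k n g

⊛-splitSum : ∀ c k n g → c ⊛ splitSum k n g ≗ splitSum k n (λ i → c ⊛ g i)
⊛-splitSum c k n g t = begin
  (c ⊛ splitSum k n g) t                              ≡⟨ ⊛-distribˡ-⊕ c (xS (sumTo k g)) (sumRange k n g) t ⟩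
  (c ⊛ xS (sumTo k g)) t + (c ⊛ sumRange k n g) t
    ≡⟨ cong₂ _+_ (trans (⊛-xS c (sumTo k g) t) (xS-cong (⊛-sumTo c k g) t))
                 (⊛-sumTo c (n ∸ k) (λ i → g (k ℕ.+ i)) t) ⟩
  splitSum k n (λ i → c ⊛ g i) t                      ∎
  where open ≡-Reasoning

fVal-pascal : ∀ {n k} m → k ≤ n → fVal n k m ℕ.+ fVal (suc n) (suc k) m ≡ fVal (suc n) k m
fVal-pascal {n} {k} m k≤n = trans
  (factor (m ^ k) (suc m ^ (n ∸ k)) m)
  (cong (λ e → m ^ k ℕ.* suc m ^ e) (sym (ℕₚ.+-∸-assoc 1 k≤n)))
  where
  factor : ∀ a e m → a ℕ.* e ℕ.+ m ℕ.* a ℕ.* e ≡ a ℕ.* ((1 ℕ.+ m) ℕ.* e)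
  factor = ℕ-Solver.solve-∀

fSeries-pascal : ∀ {n k} m → k ≤ n → fSeries n k m + fSeries (suc n) (suc k) m ≡ fSeries (suc n) k m
fSeries-pascal {n} {k} m k≤n = trans (sym (ℤₚ.pos-+ (fVal n k m) _)) (cong +_ (fVal-pascal m k≤n))

fSeries-prefix : ∀ {n k} m → k ≤ suc n → fSeries (suc n) k m + sumTo k (fSeries n) m ≡ + (suc m ^ suc n)
fSeries-prefix {n} {zero} m _ = trans (ℤₚ.+-identityʳ _) (cong +_ (ℕₚ.*-identityˡ (suc m ^ suc n)))
fSeries-prefix {n} {suc k} m (s≤s k≤n) = begin
  fSeries (suc n) (suc k) m + (sumTo k (fSeries n) m + fSeries n k m)
    ≡⟨ regroup (fSeries (suc n) (suc k) m) (sumTo k (fSeries n) m) (fSeries n k m) ⟩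
  (fSeries n k m + fSeries (suc n) (suc k) m) + sumTo k (fSeries n) m
    ≡⟨ cong (_+ sumTo k (fSeries n) m) (fSeries-pascal m k≤n) ⟩
  fSeries (suc n) k m + sumTo k (fSeries n) m
    ≡⟨ fSeries-prefix m (ℕₚ.m≤n⇒m≤1+n k≤n) ⟩
  + (suc m ^ suc n) ∎
  where
  open ≡-Reasoning
  regroup : ∀ a b c → a + (b + c) ≡ (c + a) + b
  regroup = ℤ-Solver.solve-∀

fSeries-telescope : ∀ {n k} d m → k ℕ.+ d ≤ suc n →
  fSeries (suc n) k m ≡ sumTo d (λ i → fSeries n (k ℕ.+ i)) m + fSeries (suc n) (k ℕ.+ d) m
fSeries-telescope {n} {k} zero m _ = sym (trans (ℤₚ.+-identityˡ _) (cong (λ l → fSeries (suc n) l m) (ℕₚ.+-identityʳ k)))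
fSeries-telescope {n} {k} (suc d) m k+1+d≤1+n = begin
  fSeries (suc n) k m
    ≡⟨ fSeries-telescope d m (ℕₚ.m≤n⇒m≤1+n k+d≤n) ⟩
  S + fSeries (suc n) (k ℕ.+ d) m
    ≡⟨ cong (_+_ S) (fSeries-pascal m k+d≤n) ⟨
  S + (fSeries n (k ℕ.+ d) m + fSeries (suc n) (suc (k ℕ.+ d)) m)
    ≡⟨ ℤₚ.+-assoc S _ _ ⟨
  (S + fSeries n (k ℕ.+ d) m) + fSeries (suc n) (suc (k ℕ.+ d)) m
    ≡⟨ cong (λ l → (S + fSeries n (k ℕ.+ d) m) + fSeries (suc n) l m) (ℕₚ.+-suc k d) ⟨
  (S + fSeries n (k ℕ.+ d) m) + fSeries (suc n) (k ℕ.+ suc d) m ∎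
  where
  open ≡-Reasoning
  S = sumTo d (λ i → fSeries n (k ℕ.+ i)) m
  k+d≤n : k ℕ.+ d ≤ n
  k+d≤n = s≤s⁻¹ (subst (_≤ suc n) (ℕₚ.+-suc k d) k+1+d≤1+n)

fSeries-suffix : ∀ {n k} m → k ≤ suc n → fSeries (suc n) k m ≡ sumRange k (suc n) (fSeries n) m + + (m ^ suc n)
fSeries-suffix {n} {k} m k≤1+n = begin
  fSeries (suc n) k m
    ≡⟨ fSeries-telescope (suc n ∸ k) m (ℕₚ.≤-reflexive k+d≡1+n) ⟩
  sumRange k (suc n) (fSeries n) m + fSeries (suc n) (k ℕ.+ (suc n ∸ k)) m
    ≡⟨ cong (λ l → sumRange k (suc n) (fSeries n) m + fSeries (suc n) l m) k+d≡1+n ⟩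
  sumRange k (suc n) (fSeries n) m + fSeries (suc n) (suc n) m
    ≡⟨ cong (λ v → sumRange k (suc n) (fSeries n) m + + v) diagonal ⟩
  sumRange k (suc n) (fSeries n) m + + (m ^ suc n) ∎
  where
  open ≡-Reasoning
  k+d≡1+n : k ℕ.+ (suc n ∸ k) ≡ suc n
  k+d≡1+n = ℕₚ.m+[n∸m]≡n k≤1+n
  diagonal : fVal (suc n) (suc n) m ≡ m ^ suc n
  diagonal = trans (cong (λ e → m ^ suc n ℕ.* suc m ^ e) (ℕₚ.n∸n≡0 n)) (ℕₚ.*-identityʳ _)

oneMinusX-⊛-at-suc : ∀ a t → (oneMinusX ⊛ a) (suc t) ≡ a (suc t) + - a t
oneMinusX-⊛-at-suc a t = begin
  (oneMinusX ⊛ a) (suc t)                       ≡⟨ ⊛-at-suc oneMinusX a t ⟩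
  (tailS oneMinusX ⊛ a) t + + 1 * a (suc t)     ≡⟨ cong₂ _+_ (negation t) (ℤₚ.*-identityˡ (a (suc t))) ⟩
  - a t + a (suc t)                             ≡⟨ ℤₚ.+-comm (- a t) (a (suc t)) ⟩
  a (suc t) + - a t                             ∎
  where
  open ≡-Reasoning
  negation : ∀ t → (tailS oneMinusX ⊛ a) t ≡ - a t
  negation zero    = trans (⊛-at-0 (tailS oneMinusX) a) (ℤₚ.-1*i≡-i (a 0))
  negation (suc t) = trans (⊛-at-suc (tailS oneMinusX) a t)
    (trans (cong₂ _+_ (⊛-zeroˡ a t) (ℤₚ.-1*i≡-i (a (suc t)))) (ℤₚ.+-identityˡ _))

oneMinusX-⊛-fSeries : ∀ {n k} → k ≤ suc n → oneMinusX ⊛ fSeries (suc n) k ≗ splitSum k (suc n) (fSeries n)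
oneMinusX-⊛-fSeries {n} {k} k≤1+n zero = begin
  (oneMinusX ⊛ fSeries (suc n) k) 0         ≡⟨ trans (⊛-at-0 oneMinusX (fSeries (suc n) k)) (ℤₚ.*-identityˡ _) ⟩
  fSeries (suc n) k 0                       ≡⟨ fSeries-suffix 0 k≤1+n ⟩
  sumRange k (suc n) (fSeries n) 0 + + 0    ≡⟨ ℤₚ.+-comm (sumRange k (suc n) (fSeries n) 0) (+ 0) ⟩
  splitSum k (suc n) (fSeries n) 0          ∎
  where open ≡-Reasoning
oneMinusX-⊛-fSeries {n} {k} k≤1+n (suc t) = begin
  (oneMinusX ⊛ F) (suc t)           ≡⟨ oneMinusX-⊛-at-suc F t ⟩
  F (suc t) + - F t                 ≡⟨ cong (_+ - F t) (fSeries-suffix (suc t) k≤1+n) ⟩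
  (B + + (suc t ^ suc n)) + - F t   ≡⟨ cong (λ v → (B + v) + - F t) (fSeries-prefix t k≤1+n) ⟨
  (B + (F t + A)) + - F t           ≡⟨ cancel B (F t) A ⟩
  A + B                             ∎
  where
  open ≡-Reasoning
  F = fSeries (suc n) k
  A = sumTo k (fSeries n) t
  B = sumRange k (suc n) (fSeries n) (suc t)
  cancel : ∀ b f a → (b + (f + a)) + - f ≡ a + b
  cancel = ℤ-Solver.solve-∀

p-recurrence : ∀ {n k} → k ≤ suc n → p (suc n) k ≗ splitSum k (suc n) (p n)
p-recurrence {n} {k} k≤1+n t = begin
  ((oneMinusX ⊛ P) ⊛ F) t                   ≡⟨ ⊛-congˡ F (⊛-comm oneMinusX P) t ⟩
  ((P ⊛ oneMinusX) ⊛ F) t                   ≡⟨ ⊛-assoc P oneMinusX F t ⟩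
  (P ⊛ (oneMinusX ⊛ F)) t                   ≡⟨ ⊛-congʳ P (oneMinusX-⊛-fSeries k≤1+n) t ⟩
  (P ⊛ splitSum k (suc n) (fSeries n)) t    ≡⟨ ⊛-splitSum P k (suc n) (fSeries n) t ⟩
  splitSum k (suc n) (p n) t                ∎
  where
  open ≡-Reasoning
  P = powS oneMinusX (suc n)
  F = fSeries (suc n) k

xS^ : ℕ → Series → Series
xS^ zero    a = a
xS^ (suc e) a = xS (xS^ e a)

xS^-eval : ∀ e a {s t} → e ℕ.+ t ≡ s → xS^ e a s ≡ a t
xS^-eval zero    a refl = refl
xS^-eval (suc e) a refl = xS^-eval e a refl

xS^-low : ∀ e a {s} → s < e → xS^ e a s ≡ + 0
xS^-low (suc e) a {zero}  _         = refl
xS^-low (suc e) a {suc s} (s≤s s<e) = xS^-low e a s<e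

xS-zero : xS zeroS ≗ zeroS
xS-zero zero    = refl
xS-zero (suc t) = refl

geomS-suc : ∀ r → geomS (suc r) ≗ xS (geomS r) ⊕ oneS
geomS-suc r zero    = refl
geomS-suc r (suc t) = sym (ℤₚ.+-identityʳ _)

geomS-⊛ : ∀ r a → geomS r ⊛ a ≗ sumTo r (λ l → xS^ (r ∸ suc l) a)
geomS-⊛ zero    a = ⊛-zeroˡ a
geomS-⊛ (suc r) a t = begin
  (geomS (suc r) ⊛ a) t                          ≡⟨ ⊛-congˡ a (geomS-suc r) t ⟩
  ((xS (geomS r) ⊕ oneS) ⊛ a) t                  ≡⟨ ⊛-distribʳ-⊕ (xS (geomS r)) oneS a t ⟩
  (xS (geomS r) ⊛ a) t + (oneS ⊛ a) t
    ≡⟨ cong₂ _+_ (trans (xS-⊛ (geomS r) a t) (xS-cong (geomS-⊛ r a) t)) (⊛-identityˡ a t) ⟩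
  xS (sumTo r (λ l → xS^ (r ∸ suc l) a)) t + a t ≡⟨ cong (_+ a t) (xS-sumTo r (λ l → xS^ (r ∸ suc l) a) t) ⟩
  sumTo r (λ l → xS^ (suc (r ∸ suc l)) a) t + a t
    ≡⟨ cong₂ _+_ (sumTo-cong r (λ l l<r → cong (λ e → xS^ e a t) (ℕₚ.+-∸-assoc 1 l<r)))
                 (cong (λ e → xS^ e a t) (ℕₚ.n∸n≡0 r)) ⟨
  sumTo (suc r) (λ l → xS^ (suc r ∸ suc l) a) t  ∎
  where open ≡-Reasoning

far-index : ∀ {d i} j R → i < d → (d ℕ.+ suc j) ∸ suc i ℕ.+ (R ℕ.+ (suc j ℕ.+ i)) ≡ d ℕ.+ suc j ℕ.+ R ℕ.+ j
far-index {d} {i} j R i<d = begin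
  (d ℕ.+ suc j) ∸ suc i ℕ.+ (R ℕ.+ (suc j ℕ.+ i))        ≡⟨ cong (ℕ._+ (R ℕ.+ (suc j ℕ.+ i))) (ℕₚ.+-∸-comm (suc j) i<d) ⟩
  (d ∸ suc i ℕ.+ suc j) ℕ.+ (R ℕ.+ (suc j ℕ.+ i))        ≡⟨ regroup (d ∸ suc i) i j R ⟩
  (d ∸ suc i ℕ.+ suc i) ℕ.+ suc j ℕ.+ R ℕ.+ j            ≡⟨ cong (λ x → x ℕ.+ suc j ℕ.+ R ℕ.+ j) (ℕₚ.m∸n+n≡m i<d) ⟩
  d ℕ.+ suc j ℕ.+ R ℕ.+ j                                ∎
  where
  open ≡-Reasoning
  regroup : ∀ q i j R → (q ℕ.+ suc j) ℕ.+ (R ℕ.+ (suc j ℕ.+ i)) ≡ (q ℕ.+ suc i) ℕ.+ suc j ℕ.+ R ℕ.+ j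
  regroup = ℕ-Solver.solve-∀

near-index : ∀ d {i j} R → i ≤ j → (d ℕ.+ suc j) ∸ suc (d ℕ.+ i) ℕ.+ (R ℕ.+ i) ≡ R ℕ.+ j
near-index d {i} {j} R i≤j = begin
  (d ℕ.+ suc j) ∸ suc (d ℕ.+ i) ℕ.+ (R ℕ.+ i)   ≡⟨ cong (λ x → (d ℕ.+ suc j) ∸ x ℕ.+ (R ℕ.+ i)) (ℕₚ.+-suc d i) ⟨
  (d ℕ.+ suc j) ∸ (d ℕ.+ suc i) ℕ.+ (R ℕ.+ i)   ≡⟨ cong (ℕ._+ (R ℕ.+ i)) (ℕₚ.[m+n]∸[m+o]≡n∸o d (suc j) (suc i)) ⟩
  j ∸ i ℕ.+ (R ℕ.+ i)                           ≡⟨ ℕₚ.+-comm (j ∸ i) (R ℕ.+ i) ⟩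
  R ℕ.+ i ℕ.+ (j ∸ i)                           ≡⟨ ℕₚ.+-assoc R i (j ∸ i) ⟩
  R ℕ.+ (i ℕ.+ (j ∸ i))                         ≡⟨ cong (R ℕ.+_) (ℕₚ.m+[n∸m]≡n i≤j) ⟩
  R ℕ.+ j                                       ∎
  where open ≡-Reasoning

-- Of the terms x^(r-1-l) of geomS r, those with l < d reach back into the previous block of r
-- coefficients (index r(m-1) + j+1+l), the others stay in the current one (index rm + l - d).
section-geomS-⊛′ : ∀ d j A → let r = d ℕ.+ suc j in section r j (geomS r ⊛ A) ≗
  xS (sumRange (suc j) r (λ l → section r l A)) ⊕ sumTo (suc j) (λ l → section r l A)
section-geomS-⊛′ d j A m = begin
  (geomS r ⊛ A) t                                      ≡⟨ geomS-⊛ r A t ⟩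
  sumTo r h t                                          ≡⟨ sumTo-split d (suc j) h t ⟩
  sumTo d h t + sumTo (suc j) (λ i → h (d ℕ.+ i)) t    ≡⟨ cong₂ _+_ far-part near-part ⟩
  xS (sumRange (suc j) r (λ l → section r l A)) m + sumTo (suc j) (λ l → section r l A) m ∎
  where
  open ≡-Reasoning
  r = d ℕ.+ suc j
  t = r ℕ.* m ℕ.+ j
  h : ℕ → Series
  h l = xS^ (r ∸ suc l) A
  far : ∀ m i → i < d → h i (r ℕ.* m ℕ.+ j) ≡ xS (section r (suc j ℕ.+ i) A) m
  far zero i i<d = xS^-low (r ∸ suc i) A
    (subst₂ _<_ (sym (cong (ℕ._+ j) (ℕₚ.*-zeroʳ r))) (sym (ℕₚ.+-∸-comm (suc j) i<d))
            (ℕₚ.m≤n+m (suc j) (d ∸ suc i)))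
  far (suc m) i i<d = xS^-eval (r ∸ suc i) A
    (trans (far-index j (r ℕ.* m) i<d) (cong (ℕ._+ j) (sym (ℕₚ.*-suc r m))))
  far-part : sumTo d h t ≡ xS (sumRange (suc j) r (λ l → section r l A)) m
  far-part = begin
    sumTo d h t                                              ≡⟨ sumTo-cong d (far m) ⟩
    sumTo d (λ i → xS (section r (suc j ℕ.+ i) A)) m         ≡⟨ xS-sumTo d (λ i → section r (suc j ℕ.+ i) A) m ⟨
    xS (sumTo d (λ i → section r (suc j ℕ.+ i) A)) m
      ≡⟨ cong (λ n → xS (sumTo n (λ i → section r (suc j ℕ.+ i) A)) m) (ℕₚ.m+n∸n≡m d (suc j)) ⟨
    xS (sumRange (suc j) r (λ l → section r l A)) m          ∎
  near-part : sumTo (suc j) (λ i → h (d ℕ.+ i)) t ≡ sumTo (suc j) (λ l → section r l A) m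
  near-part = sumTo-cong (suc j) (λ i i<1+j → xS^-eval (r ∸ suc (d ℕ.+ i)) A (near-index d (r ℕ.* m) (s≤s⁻¹ i<1+j)))

section-geomS-⊛ : ∀ {r j} → j < r → ∀ A → section r j (geomS r ⊛ A) ≗
  xS (sumRange (suc j) r (λ l → section r l A)) ⊕ sumTo (suc j) (λ l → section r l A)
section-geomS-⊛ {r} {j} j<r A m rewrite sym (ℕₚ.m∸n+n≡m j<r) = section-geomS-⊛′ (r ∸ suc j) j A m

-- Multiplying by x moves the boundary of the window from j to j - 1, wrapping round to r - 1 at j = 0.
section-geomS-⊛-xS : ∀ {r j} → j < r → ∀ A → section r j (geomS r ⊛ xS A) ≗
  xS (sumRange j r (λ l → section r l A)) ⊕ sumTo j (λ l → section r l A)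
section-geomS-⊛-xS {r} {suc j} 1+j<r A m = begin
  (geomS r ⊛ xS A) (r ℕ.* m ℕ.+ suc j)   ≡⟨ ⊛-xS (geomS r) A _ ⟩
  xS (geomS r ⊛ A) (r ℕ.* m ℕ.+ suc j)   ≡⟨ cong (xS (geomS r ⊛ A)) (ℕₚ.+-suc (r ℕ.* m) j) ⟩
  (geomS r ⊛ A) (r ℕ.* m ℕ.+ j)          ≡⟨ section-geomS-⊛ (ℕₚ.<-trans (ℕₚ.n<1+n j) 1+j<r) A m ⟩
  (xS (sumRange (suc j) r (λ l → section r l A)) ⊕ sumTo (suc j) (λ l → section r l A)) m ∎
  where open ≡-Reasoning
section-geomS-⊛-xS {r} {zero} _ A zero =
  trans (⊛-xS (geomS r) A _) (cong (xS (geomS r ⊛ A)) (trans (ℕₚ.+-identityʳ (r ℕ.* 0)) (ℕₚ.*-zeroʳ r)))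
section-geomS-⊛-xS {suc r} {zero} _ A (suc m) = begin
  (geomS (suc r) ⊛ xS A) (suc r ℕ.* suc m ℕ.+ 0)   ≡⟨ ⊛-xS (geomS (suc r)) A _ ⟩
  xS (geomS (suc r) ⊛ A) (suc r ℕ.* suc m ℕ.+ 0)   ≡⟨ cong (xS (geomS (suc r) ⊛ A)) (index r m) ⟩
  (geomS (suc r) ⊛ A) (suc r ℕ.* m ℕ.+ r)          ≡⟨ section-geomS-⊛ (ℕₚ.n<1+n r) A m ⟩
  xS (sumRange (suc r) (suc r) sec) m + sumTo (suc r) sec m
    ≡⟨ cong (_+ sumTo (suc r) sec m) (trans (xS-cong (sumRange-empty (suc r) sec) m) (xS-zero m)) ⟩
  + 0 + sumTo (suc r) sec m                        ≡⟨ ℤₚ.+-comm (+ 0) (sumTo (suc r) sec m) ⟩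
  sumTo (suc r) sec m + + 0                        ∎
  where
  open ≡-Reasoning
  sec : ℕ → Series
  sec l = section (suc r) l A
  index : ∀ r m → suc r ℕ.* suc m ℕ.+ 0 ≡ suc (suc r ℕ.* m ℕ.+ r)
  index = ℕ-Solver.solve-∀

section-geomS-⊛-xS⊕ : ∀ {r j} → j < r → ∀ U V → section r j (geomS r ⊛ (xS U ⊕ V)) ≗
  xS (sumRange (suc j) r (λ l → section r l (U ⊕ V))) ⊕ xS (section r j U) ⊕ section r j V
    ⊕ sumTo j (λ l → section r l (U ⊕ V))
section-geomS-⊛-xS⊕ {r} {j} j<r U V m = begin
  (geomS r ⊛ (xS U ⊕ V)) (r ℕ.* m ℕ.+ j)
    ≡⟨ ⊛-distribˡ-⊕ (geomS r) (xS U) V _ ⟩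
  (geomS r ⊛ xS U) (r ℕ.* m ℕ.+ j) + (geomS r ⊛ V) (r ℕ.* m ℕ.+ j)
    ≡⟨ cong₂ _+_ (section-geomS-⊛-xS j<r U m) (section-geomS-⊛ j<r V m) ⟩
  (xS (sumRange j r u) m + sumTo j u m) + (xS (sumRange (suc j) r v) m + (sumTo j v m + v j m))
    ≡⟨ cong (λ z → (z + sumTo j u m) + (xS (sumRange (suc j) r v) m + (sumTo j v m + v j m)))
            (trans (xS-cong (sumRange-head u j<r) m) (xS-⊕ (u j) (sumRange (suc j) r u) m)) ⟩
  ((xS (u j) m + xS (sumRange (suc j) r u) m) + sumTo j u m)
    + (xS (sumRange (suc j) r v) m + (sumTo j v m + v j m))
    ≡⟨ regroup (xS (u j) m) (xS (sumRange (suc j) r u) m) (sumTo j u m)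
               (xS (sumRange (suc j) r v) m) (sumTo j v m) (v j m) ⟩
  (((xS (sumRange (suc j) r u) m + xS (sumRange (suc j) r v) m) + xS (u j) m) + v j m)
    + (sumTo j u m + sumTo j v m)
    ≡⟨ cong₂ (λ a b → ((a + xS (u j) m) + v j m) + b)
             (trans (xS-cong (sumTo-⊕ (r ∸ suc j) (λ i → u (suc j ℕ.+ i)) (λ i → v (suc j ℕ.+ i))) m)
                    (xS-⊕ (sumRange (suc j) r u) (sumRange (suc j) r v) m))
             (sumTo-⊕ j u v m) ⟨
  (xS (sumRange (suc j) r (λ l → section r l (U ⊕ V))) ⊕ xS (u j) ⊕ v j
    ⊕ sumTo j (λ l → section r l (U ⊕ V))) m ∎
  where
  open ≡-Reasoning
  u v : ℕ → Series
  u l = section r l U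
  v l = section r l V
  regroup : ∀ a b c d e f → ((a + b) + c) + (d + (e + f)) ≡ (((b + d) + a) + f) + (c + e)
  regroup = ℤ-Solver.solve-∀

section-geomS-⊛-splitSum : ∀ {r j k n} → j < r → k ≤ n → ∀ Q m →
  section r j (geomS r ⊛ splitSum k n Q) m ≡
    ( xS (sumRange (suc j) r (λ l → sumTo n (λ i → section r l (Q i))))
    ⊕ xS (sumTo k (λ i → section r j (Q i)))
    ⊕ sumRange k n (λ i → section r j (Q i))
    ⊕ sumTo j (λ l → sumTo n (λ i → section r l (Q i))) ) m
section-geomS-⊛-splitSum {r} {j} {k} {n} j<r k≤n Q m =
  trans (section-geomS-⊛-xS⊕ j<r (sumTo k Q) (sumRange k n Q) m)
    (cong₂ _+_
      (cong₂ _+_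
        (cong₂ _+_ (xS-cong (λ m → sumTo-cong (r ∸ suc j) (λ l _ → recombine (suc j ℕ.+ l) m)) m)
                   (xS-cong (section-sumTo r j k Q) m))
        (section-sumTo r j (n ∸ k) (λ i → Q (k ℕ.+ i)) m))
      (sumTo-cong j (λ l _ → recombine l m)))
  where
  recombine : ∀ l → section r l (sumTo k Q ⊕ sumRange k n Q) ≗ sumTo n (λ i → section r l (Q i))
  recombine l m = trans (sym (sumTo≗sumTo⊕sumRange Q k≤n (r ℕ.* m ℕ.+ l))) (section-sumTo r l n Q m)

⊛-p-recurrence : ∀ c {n k} → k ≤ suc n → c ⊛ p (suc n) k ≗ splitSum k (suc n) (λ i → c ⊛ p n i)
⊛-p-recurrence c {n} {k} k≤1+n t =
  trans (⊛-congʳ c (p-recurrence k≤1+n) t) (⊛-splitSum c k (suc n) (p n) t)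

proposition5p6 : (r : ℕ) → 1 ≤ r → (n k j : ℕ) → 1 ≤ n → k ≤ n → j < r →
    (m : ℕ) →
      pr r j n k m ≡
        ( xS (sumRange (suc j) r (λ l → sumTo n (λ i → pr r l (n ∸ 1) i)))
        ⊕ xS (sumTo k (λ i → pr r j (n ∸ 1) i))
        ⊕ sumRange k n (λ i → pr r j (n ∸ 1) i)
        ⊕ sumTo j (λ l → sumTo n (λ i → pr r l (n ∸ 1) i)) ) m
proposition5p6 r _ (suc n) k j _ k≤1+n j<r m = begin
  section r j (powS G (suc n) ⊛ p (suc n) k) m
    ≡⟨ ⊛-assoc G (powS G n) (p (suc n) k) (r ℕ.* m ℕ.+ j) ⟩
  section r j (G ⊛ (powS G n ⊛ p (suc n) k)) m
    ≡⟨ ⊛-congʳ G (⊛-p-recurrence (powS G n) k≤1+n) (r ℕ.* m ℕ.+ j) ⟩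
  section r j (G ⊛ splitSum k (suc n) (λ i → powS G n ⊛ p n i)) m
    ≡⟨ section-geomS-⊛-splitSum j<r k≤1+n (λ i → powS G n ⊛ p n i) m ⟩
  _ ∎
  where
  open ≡-Reasoning
  G = geomS r
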